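{- Let $\Gamma$ be a subgroup of $\mathrm{SL}_2(\mathbb{Z})$ containing $\Gamma_1(N)$. Then $\Gamma$ acts on $\mathcal{Q}(D_\mathcal{O},N)$ (i.e. $Q(\gamma\,(x,y)^T)\in\mathcal{Q}(D_\mathcal{O},N)$ for all $Q\in\mathcal{Q}(D_\mathcal{O},N)$ and $\gamma\in\Gamma$) if and only if $\Gamma$ is contained in $\Gamma_0(M_{D_\mathcal{O},N})$.
   Context: $N$ is a positive integer, $K$ an imaginary quadratic field, $\mathcal{O}$ an order of discriminant $D_\mathcal{O}$ in $K$. $\Gamma_1(N)=\{\gamma\in\mathrm{SL}_2(\mathbb{Z}) : \gamma\equiv\left[\begin{smallmatrix}1&*\\0&1\end{smallmatrix}\right] \pmod{N M_2(\mathbb{Z})}\}$, $\Gamma_0(n)=\{\gamma\in\mathrm{SL}_2(\mathbb{Z}) : \gamma\equiv\left[\begin{smallmatrix}*&*\\0&*\end{smallmatrix}\right] \pmod{n M_2(\mathbb{Z})}\}$. $\mathcal{Q}(D_\mathcal{O},N)$ is the set of forms $ax^2+bxy+cy^2\in\mathbb{Z}[x,y]$ with $\gcd(a,b,c)=1$, $b^2-4ac=D_\mathcal{O}$, $a>0$, $\gcd(a,N)=1$. $M_{D_\mathcal{O},N}$ is the product of all prime factors $p$ of $N$ such that $\left(\frac{D_\mathcal{O}}{p}\right)\neq-1$, where this is the Legendre symbol for odd $p$ and the Kronecker symbol for $p=2$ (empty product $=1$). -}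

module Defs where

open import Data.Bool using (Bool; true; false; if_then_else_; _∨_)
open import Data.Nat as ℕ using (ℕ; zero; suc; _≡ᵇ_)
open import Data.Nat.GCD using (gcd)
open import Data.Nat.Primality using (Prime; prime?)
open import Data.Nat.Divisibility as ℕD using (_∣?_)
open import Data.Integer as ℤ using (ℤ; +_; -[1+_]; _-_; _*_; _+_; _<_; ∣_∣)
open import Data.Integer.DivMod using (_%ℕ_)
open import Data.Integer.Divisibility using (_∣_)
open import Data.List using (List; upTo; filter)
open import Data.Nat.ListAction using (product)
open import Data.Bool.ListAction using (any)
open import Data.Product using (_×_)
open import Data.Sum using (_⊎_)
open import Relation.Nullary using (¬_; ¬?)
open import Relation.Nullary.Decidable using (_×-dec_)
open import Relation.Binary.PropositionalEquality using (_≡_)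

record Mat : Set where
  constructor mat
  field a b c d : ℤ
open Mat public

det : Mat → ℤ
det (mat a b c d) = a * d - b * c

InSL2 : Mat → Set
InSL2 γ = det γ ≡ + 1

idMat : Mat
idMat = mat (+ 1) (+ 0) (+ 0) (+ 1)

_·_ : Mat → Mat → Mat
mat a b c d · mat a' b' c' d' =
  mat (a * a' + b * c') (a * b' + b * d') (c * a' + d * c') (c * b' + d * d')

invSL2 : Mat → Mat
invSL2 (mat a b c d) = mat d (ℤ.- b) (ℤ.- c) a

record IsSubgroupSL2 (Γ : Mat → Set) : Set where
  field
    ⊆SL2   : ∀ γ → Γ γ → InSL2 γ
    has-id : Γ idMat
    ·-closed : ∀ γ δ → Γ γ → Γ δ → Γ (γ · δ)
    inv-closed : ∀ γ → Γ γ → Γ (invSL2 γ)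

_≡_[mod_] : ℤ → ℤ → ℕ → Set
x ≡ y [mod n ] = (+ n) ∣ (x - y)

InΓ1 : ℕ → Mat → Set
InΓ1 N γ = InSL2 γ × (a γ ≡ + 1 [mod N ]) × (c γ ≡ + 0 [mod N ]) × (d γ ≡ + 1 [mod N ])

InΓ0 : ℕ → Mat → Set
InΓ0 n γ = InSL2 γ × (c γ ≡ + 0 [mod n ])

-- binary quadratic form A x² + B x y + C y²
record Form : Set where
  constructor form
  field A B C : ℤ
open Form public

-- Q ∘ γ : (x , y) ↦ Q (a x + b y , c x + d y), coefficients expanded
act : Form → Mat → Form
act (form A B C) (mat a b c d) =
  form (A * a * a + B * a * c + C * c * c)
       (+ 2 * A * a * b + B * (a * d + b * c) + + 2 * C * c * d)
       (A * b * b + B * b * d + C * d * d)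

disc : Form → ℤ
disc (form A B C) = B * B - + 4 * A * C

InQ : ℤ → ℕ → Form → Set
InQ D N Q =
  (gcd (gcd ∣ A Q ∣ ∣ B Q ∣) ∣ C Q ∣ ≡ 1) × (disc Q ≡ D) × (+ 0 < A Q) × (gcd ∣ A Q ∣ N ≡ 1)

IsImagQuadOrderDisc : ℤ → Set
IsImagQuadOrderDisc D = (D < + 0) × ((D %ℕ 4 ≡ 0) ⊎ (D %ℕ 4 ≡ 1))

-- Kronecker symbol (D / p) for a prime p (Legendre symbol for odd p);
-- value at non-primes is irrelevant.
kronecker : ℤ → ℕ → ℤ
kronecker D zero = + 0
kronecker D p@(suc k) =
  if p ≡ᵇ 2
  then (if D %ℕ 2 ≡ᵇ 0 then + 0
        else if (D %ℕ 8 ≡ᵇ 1) ∨ (D %ℕ 8 ≡ᵇ 7) then + 1 else -[1+ 0 ])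
  else (if D %ℕ p ≡ᵇ 0 then + 0
        else if any (λ x → ((+ x) * (+ x) - D) %ℕ p ≡ᵇ 0) (upTo p)
             then + 1 else -[1+ 0 ])

M : ℤ → ℕ → ℕ
M D N = product (filter (λ p → prime? p ×-dec (p ∣? N) ×-dec ¬? (kronecker D p ℤ.≟ -[1+ 0 ]))
                        (upTo (suc N)))

ActsOnQ : ℤ → ℕ → (Mat → Set) → Set
ActsOnQ D N Γ = ∀ γ → Γ γ → ∀ Q → InQ D N Q → InQ D N (act Q γ)

module Submission where

-- The transform Q ∘ γ of Q = [A, B, C] by γ = [a b; c d] has leading coefficient Q(a, c), while
-- content, discriminant and (as D < 0) positivity are SL₂(ℤ)-invariant; so γ maps 𝒬(D, N) into
-- itself iff Q(a, c) is prime to N for every Q ∈ 𝒬(D, N). Let p ∣ N be prime, so that p ∤ A.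
-- If M ∣ c and (D/p) ≠ -1, then p ∣ c and Q(a, c) ≡ A a² ≢ 0 (mod p). If (D/p) = -1 and p is
-- odd, 4A·Q(a, c) = (2Aa + Bc)² - D c² ≢ 0 because D is not a square mod p; for p = 2 we have
-- D ≡ 5 (mod 8), which makes A, B, C odd and Q(a, c) ≡ a² + ac + c² ≢ 0 (mod 2).
-- Conversely, if (D/p) ≠ -1 and p ∤ c, some form x² + Bxy + Cy² of discriminant D vanishes
-- at (a, c) mod p; it lies in 𝒬(D, N) but its transform by γ does not.

open import Defs
open import Data.Bool using (true; false; T)
open import Data.Bool.ListAction using (any)
open import Data.Empty using (⊥; ⊥-elim)
open import Data.Integer as ℤ using (ℤ; +_; -[1+_]; _+_; _-_; _*_; -_; ∣_∣)
open import Data.Integer.DivMod using (_%ℕ_; _/ℕ_; a≡a%ℕn+[a/ℕn]*n; n%ℕd<d)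
import Data.Integer.Divisibility.Signed as ℤD
import Data.Integer.Properties as ℤP
open import Data.Integer.Tactic.RingSolver using (solve-∀)
open import Data.List using ([]; _∷_; upTo; filter)
open import Data.List.Membership.Propositional using (_∈_; lose)
open import Data.List.Membership.Propositional.Properties using (∈-upTo⁺; ∈-filter⁺; ∈-filter⁻)
open import Data.List.Relation.Unary.All as All using (All; []; _∷_)
open import Data.List.Relation.Unary.AllPairs using ([]; _∷_)
open import Data.List.Relation.Unary.Any using (here; there; satisfied)
open import Data.List.Relation.Unary.Any.Properties using (any⁺; any⁻)
open import Data.List.Relation.Unary.Unique.Propositional using (Unique)
import Data.List.Relation.Unary.Unique.Propositional.Properties as Unique
open import Data.Nat as ℕ using (ℕ; zero; suc; NonZero; _≤_; _∸_; _≡ᵇ_)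
open import Data.Nat.Coprimality using (Coprime; coprime-Bézout; coprime-divisor; coprime⇒gcd≡1)
open import Data.Nat.Divisibility as ℕD using (_∣_; _∣?_)
open import Data.Nat.GCD using (gcd; gcd[m,n]∣m; gcd[m,n]∣n; gcd-greatest; gcd-zeroˡ; module Bézout)
open import Data.Nat.ListAction using (product)
open import Data.Nat.ListAction.Properties using (∈⇒∣product)
open import Data.Nat.Primality
  using (Prime; prime?; ¬prime[0]; ¬prime[1]; prime[2]; euclidsLemma; prime⇒irreducible)
open import Data.Nat.Primality.Factorisation using (factorise; factorisationHasAllPrimeFactors)
import Data.Nat.Properties as ℕP
open import Data.Product using (∃; ∃-syntax; _×_; _,_; proj₁; proj₂)
open import Data.Sum as Sum using (_⊎_; inj₁; inj₂; [_,_]′)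
open import Data.Unit using (tt)
open import Function.Bundles using (_⇔_; mk⇔)
open import Level using (0ℓ)
open import Relation.Binary.Bundles using (Setoid)
open import Relation.Binary.PropositionalEquality
  using (_≡_; _≢_; refl; sym; trans; cong; subst; module ≡-Reasoning)
import Relation.Binary.Reasoning.Setoid
open import Relation.Binary.Structures using (IsEquivalence)
open import Relation.Nullary using (¬_; ¬?; Dec; yes; no)
open import Relation.Nullary.Decidable using (_×-dec_; False; toWitnessFalse; decidable-stable)
open import Relation.Unary using (Decidable)

-- Congruences of integers

-- A record rather than Defs' x ≡ y [mod n ] itself, so that x, y and n can be inferred.
infix 4 _≈_[mod_]
record _≈_[mod_] (x y : ℤ) (n : ℕ) : Set where
  constructor mod-intro
  field mod-elim : x ≡ y [mod n ]
open _≈_[mod_] public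

module _ {n : ℕ} where

  private
    signed : ∀ {x y} → x ≈ y [mod n ] → + n ℤD.∣ x - y
    signed (mod-intro h) = ℤD.∣ᵤ⇒∣ h

    unsigned : ∀ {x y} → + n ℤD.∣ x - y → x ≈ y [mod n ]
    unsigned h = mod-intro (ℤD.∣⇒∣ᵤ h)

    along : ∀ {u v} → u ≡ v → + n ℤD.∣ u → + n ℤD.∣ v
    along = subst (+ n ℤD.∣_)

  ≈-reflexive : ∀ {x y} → x ≡ y → x ≈ y [mod n ]
  ≈-reflexive {x} refl = unsigned (ℤD.divides (+ 0) (trans (ℤP.+-inverseʳ x) (sym (ℤP.*-zeroˡ (+ n)))))

  ≈-refl : ∀ {x} → x ≈ x [mod n ]
  ≈-refl = ≈-reflexive refl

  ≈-sym : ∀ {x y} → x ≈ y [mod n ] → y ≈ x [mod n ]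
  ≈-sym {x} {y} h = unsigned (along (identity x y) (ℤD.∣m⇒∣-m (signed h)))
    where identity : ∀ x y → - (x - y) ≡ y - x
          identity = solve-∀

  ≈-trans : ∀ {x y z} → x ≈ y [mod n ] → y ≈ z [mod n ] → x ≈ z [mod n ]
  ≈-trans {x} {y} {z} h k = unsigned (along (identity x y z) (ℤD.∣m∣n⇒∣m+n (signed h) (signed k)))
    where identity : ∀ x y z → (x - y) + (y - z) ≡ x - z
          identity = solve-∀

  +-cong : ∀ {x x' y y'} → x ≈ x' [mod n ] → y ≈ y' [mod n ] → x + y ≈ x' + y' [mod n ]
  +-cong {x} {x'} {y} {y'} h k = unsigned (along (identity x x' y y') (ℤD.∣m∣n⇒∣m+n (signed h) (signed k)))
    where identity : ∀ x x' y y' → (x - x') + (y - y') ≡ (x + y) - (x' + y')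
          identity = solve-∀

  neg-cong : ∀ {x x'} → x ≈ x' [mod n ] → - x ≈ - x' [mod n ]
  neg-cong {x} {x'} h = unsigned (along (identity x x') (ℤD.∣m⇒∣-m (signed h)))
    where identity : ∀ x x' → - (x - x') ≡ - x - - x'
          identity = solve-∀

  -‿cong : ∀ {x x' y y'} → x ≈ x' [mod n ] → y ≈ y' [mod n ] → x - y ≈ x' - y' [mod n ]
  -‿cong h k = +-cong h (neg-cong k)

  *-cong : ∀ {x x' y y'} → x ≈ x' [mod n ] → y ≈ y' [mod n ] → x * y ≈ x' * y' [mod n ]
  *-cong {x} {x'} {y} {y'} h k =
    unsigned (along (identity x x' y y')
      (ℤD.∣m∣n⇒∣m+n (ℤD.∣n⇒∣m*n x (signed k)) (ℤD.∣m⇒∣m*n y' (signed h))))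
    where identity : ∀ x x' y y' → x * (y - y') + (x - x') * y' ≡ x * y - x' * y'
          identity = solve-∀

  *-congˡ : ∀ z {y y'} → y ≈ y' [mod n ] → z * y ≈ z * y' [mod n ]
  *-congˡ z = *-cong (≈-refl {z})

  *-congʳ : ∀ z {x x'} → x ≈ x' [mod n ] → x * z ≈ x' * z [mod n ]
  *-congʳ z x≈x' = *-cong x≈x' (≈-refl {z})

  +-congˡ : ∀ z {y y'} → y ≈ y' [mod n ] → z + y ≈ z + y' [mod n ]
  +-congˡ z = +-cong (≈-refl {z})

  +-congʳ : ∀ z {x x'} → x ≈ x' [mod n ] → x + z ≈ x' + z [mod n ]
  +-congʳ z x≈x' = +-cong x≈x' (≈-refl {z})

  ≈-isEquivalence : IsEquivalence _≈_[mod n ]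
  ≈-isEquivalence = record { refl = ≈-refl ; sym = ≈-sym ; trans = ≈-trans }

≈-setoid : ℕ → Setoid 0ℓ 0ℓ
≈-setoid n = record { isEquivalence = ≈-isEquivalence {n} }

module ≈-Reasoning (n : ℕ) = Relation.Binary.Reasoning.Setoid (≈-setoid n)

module _ {n : ℕ} where

  ≈0⇒∣ : ∀ {x} → x ≈ + 0 [mod n ] → n ∣ ∣ x ∣
  ≈0⇒∣ {x} (mod-intro h) = subst (λ t → n ∣ ∣ t ∣) (ℤP.+-identityʳ x) h

  ∣⇒≈0 : ∀ {x} → n ∣ ∣ x ∣ → x ≈ + 0 [mod n ]
  ∣⇒≈0 {x} h = mod-intro (subst (λ t → n ∣ ∣ t ∣) (sym (ℤP.+-identityʳ x)) h)

  ≈-by-multiple : ∀ {x y} k → x ≡ y + k * + n → x ≈ y [mod n ]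
  ≈-by-multiple {x} {y} k refl = mod-intro (ℤD.∣⇒∣ᵤ (ℤD.divides k (identity y k (+ n))))
    where identity : ∀ y k n → y + k * n - y ≡ k * n
          identity = solve-∀

  multiple≈0 : ∀ k → k * + n ≈ + 0 [mod n ]
  multiple≈0 k = ≈-by-multiple k (sym (ℤP.+-identityˡ (k * + n)))

  ≉-by-computation : ∀ {x y} → False (n ∣? ∣ x - y ∣) → ¬ (x ≈ y [mod n ])
  ≉-by-computation no-divisor (mod-intro h) = toWitnessFalse no-divisor h

  ≈⇒multiple : ∀ {x y} → x ≈ y [mod n ] → ∃[ k ] x ≡ y + k * + n
  ≈⇒multiple {x} {y} (mod-intro h) with ℤD.∣ᵤ⇒∣ h
  ... | ℤD.divides k x-y≡k·n = k , trans (identity x y) (cong (_+_ y) x-y≡k·n)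
    where identity : ∀ x y → x ≡ y + (x - y)
          identity = solve-∀

  ≈0⇒≈ : ∀ {x y} → x - y ≈ + 0 [mod n ] → x ≈ y [mod n ]
  ≈0⇒≈ {x} {y} (mod-intro h) = mod-intro (subst (λ t → n ∣ ∣ t ∣) (ℤP.+-identityʳ (x - y)) h)

  ≈⇒≈0 : ∀ {x y} → x ≈ y [mod n ] → x - y ≈ + 0 [mod n ]
  ≈⇒≈0 {x} {y} (mod-intro h) = mod-intro (subst (λ t → n ∣ ∣ t ∣) (sym (ℤP.+-identityʳ (x - y))) h)

≈-%ℕ : ∀ x n .{{_ : NonZero n}} → x ≈ + (x %ℕ n) [mod n ]
≈-%ℕ x n = ≈-by-multiple (x /ℕ n) (a≡a%ℕn+[a/ℕn]*n x n)

multiple-below≡0 : ∀ {m n} → n ∣ m → m ℕ.< n → m ≡ 0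
multiple-below≡0 {zero}  _   _   = refl
multiple-below≡0 {suc m} n∣m m<n = ⊥-elim (ℕD.>⇒∤ m<n n∣m)

%ℕ≡⇒≈ : ∀ {x} n .{{_ : NonZero n}} {r} → x %ℕ n ≡ r → x ≈ + r [mod n ]
%ℕ≡⇒≈ {x} n refl = ≈-%ℕ x n

private
  ≤-residues-≡ : ∀ {n t r} → t ≤ r → + t ≈ + r [mod n ] → r ℕ.< n → t ≡ r
  ≤-residues-≡ {n} {t} {r} t≤r (mod-intro n∣t-r) r<n =
    ℕP.≤-antisym t≤r (ℕP.m∸n≡0⇒m≤n (multiple-below≡0 n∣r∸t r∸t<n))
    where
      n∣r∸t : n ∣ r ∸ t
      n∣r∸t = subst (n ∣_) (trans (cong ∣_∣ (ℤP.m-n≡m⊖n t r)) (ℤP.∣⊖∣-≤ t≤r)) n∣t-r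
      r∸t<n : r ∸ t ℕ.< n
      r∸t<n = ℕP.≤-<-trans (ℕP.m∸n≤m r t) r<n

≈-residues-≡ : ∀ {n t r} → + t ≈ + r [mod n ] → t ℕ.< n → r ℕ.< n → t ≡ r
≈-residues-≡ {t = t} {r} t≈r t<n r<n with ℕP.≤-total t r
... | inj₁ t≤r = ≤-residues-≡ t≤r t≈r r<n
... | inj₂ r≤t = sym (≤-residues-≡ r≤t (≈-sym t≈r) t<n)

≈⇒%ℕ≡ : ∀ {x} n .{{_ : NonZero n}} {r} → x ≈ + r [mod n ] → r ℕ.< n → x %ℕ n ≡ r
≈⇒%ℕ≡ {x} n x≈r r<n = ≈-residues-≡ (≈-trans (≈-sym (≈-%ℕ x n)) x≈r) (n%ℕd<d x n) r<n

≈-weaken : ∀ {x y} m n → x ≈ y [mod m ℕ.* n ] → x ≈ y [mod m ]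
≈-weaken m n (mod-intro h) = mod-intro (ℕD.∣-trans (ℕD.m∣m*n n) h)

module _ {p : ℕ} (prime-p : Prime p) where

  1≉0[mod-prime] : ¬ (+ 1 ≈ + 0 [mod p ])
  1≉0[mod-prime] h = ¬prime[1] (subst Prime (ℕD.∣1⇒≡1 (≈0⇒∣ h)) prime-p)

  ≈0-product[mod-prime] : ∀ x y → x * y ≈ + 0 [mod p ] → x ≈ + 0 [mod p ] ⊎ y ≈ + 0 [mod p ]
  ≈0-product[mod-prime] x y h
    with euclidsLemma ∣ x ∣ ∣ y ∣ prime-p (subst (p ∣_) (ℤP.abs-* x y) (≈0⇒∣ h))
  ... | inj₁ p∣x = inj₁ (∣⇒≈0 p∣x)
  ... | inj₂ p∣y = inj₂ (∣⇒≈0 p∣y)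

  ≈0-cancelˡ[mod-prime] : ∀ {x y} → ¬ (x ≈ + 0 [mod p ]) → x * y ≈ + 0 [mod p ] → y ≈ + 0 [mod p ]
  ≈0-cancelˡ[mod-prime] {x} {y} x≉0 xy≈0 =
    [ (λ x≈0 → ⊥-elim (x≉0 x≈0)) , (λ y≈0 → y≈0) ]′ (≈0-product[mod-prime] x y xy≈0)

  coprime-prime : ∀ {m} → ¬ (p ∣ m) → Coprime p m
  coprime-prime p∤m {i} (i∣p , i∣m) with prime⇒irreducible prime-p i∣p
  ... | inj₁ i≡1 = i≡1
  ... | inj₂ refl = ⊥-elim (p∤m i∣m)

  private
    pos-linear : ∀ {x y m n} → 1 ℕ.+ y ℕ.* m ≡ x ℕ.* n → + 1 + + y * + m ≡ + x * + n
    pos-linear {x} {y} {m} {n} eq = begin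
      + 1 + + y * + m      ≡⟨ cong (_+_ (+ 1)) (ℤP.pos-* y m) ⟨
      + 1 + + (y ℕ.* m)    ≡⟨ ℤP.pos-+ 1 (y ℕ.* m) ⟨
      + (1 ℕ.+ y ℕ.* m)    ≡⟨ cong +_ eq ⟩
      + (x ℕ.* n)          ≡⟨ ℤP.pos-* x n ⟩
      + x * + n            ∎
      where open ≡-Reasoning

    inverse-of-natural : ∀ {m} → ¬ (p ∣ m) → ∃[ u ] u * + m ≈ + 1 [mod p ]
    inverse-of-natural {m} p∤m with coprime-Bézout (coprime-prime p∤m)
    ... | Bézout.+- x y eq = - + y , ≈-by-multiple (- + x) (begin
      - + y * + m             ≡⟨ identity (+ y) (+ m) ⟩
      + 1 - (+ 1 + + y * + m) ≡⟨ cong (λ t → + 1 - t) (pos-linear {x} {y} {m} {p} eq) ⟩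
      + 1 - + x * + p         ≡⟨ cong (_+_ (+ 1)) (ℤP.neg-distribˡ-* (+ x) (+ p)) ⟩
      + 1 + - + x * + p       ∎)
      where
        open ≡-Reasoning
        identity : ∀ y m → - y * m ≡ + 1 - (+ 1 + y * m)
        identity = solve-∀
    ... | Bézout.-+ x y eq = + y , ≈-by-multiple (+ x) (sym (pos-linear {y} {x} {p} {m} eq))

  ≈0-or-invertible[mod-prime] : ∀ c → c ≈ + 0 [mod p ] ⊎ ∃[ u ] u * c ≈ + 1 [mod p ]
  ≈0-or-invertible[mod-prime] c with p ∣? ∣ c ∣
  ... | yes p∣c = inj₁ (∣⇒≈0 p∣c)
  ≈0-or-invertible[mod-prime] (+ m) | no p∤m = inj₂ (inverse-of-natural p∤m)
  ≈0-or-invertible[mod-prime] -[1+ m ] | no p∤m with inverse-of-natural p∤m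
  ... | u , u·m≈1 = inj₂ (- u , ≈-trans (≈-reflexive (identity u (+ suc m))) u·m≈1)
    where identity : ∀ u m → - u * - m ≡ u * m
          identity = solve-∀

  unimodular⇒column≉0[mod-prime] : ∀ {a b c d} → a * d - b * c ≡ + 1 →
    ¬ (a ≈ + 0 [mod p ] × c ≈ + 0 [mod p ])
  unimodular⇒column≉0[mod-prime] {a} {b} {c} {d} det≡1 (a≈0 , c≈0) = 1≉0[mod-prime] (begin
    + 1                ≡⟨ det≡1 ⟨
    a * d - b * c      ≈⟨ -‿cong (*-congʳ d a≈0) (*-congˡ b c≈0) ⟩
    + 0 * d - b * + 0  ≡⟨ identity b d ⟩
    + 0                ∎)
    where
      open ≈-Reasoning p
      identity : ∀ b d → + 0 * d - b * + 0 ≡ + 0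
      identity = solve-∀

  module _ (p≢2 : p ≢ 2) where

    2≉0[mod-odd-prime] : ¬ (+ 2 ≈ + 0 [mod p ])
    2≉0[mod-odd-prime] 2≈0 with prime⇒irreducible prime[2] (≈0⇒∣ 2≈0)
    ... | inj₁ refl = ¬prime[1] prime-p
    ... | inj₂ p≡2  = p≢2 p≡2

    ∃half[mod-odd-prime] : ∃[ h ] h * + 2 ≈ + 1 [mod p ]
    ∃half[mod-odd-prime] with ≈0-or-invertible[mod-prime] (+ 2)
    ... | inj₁ 2≈0 = ⊥-elim (2≉0[mod-odd-prime] 2≈0)
    ... | inj₂ half = half

parity : ∀ x → x ≈ + 0 [mod 2 ] ⊎ x ≈ + 1 [mod 2 ]
parity x with x %ℕ 2 | ≈-%ℕ x 2 | n%ℕd<d x 2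
... | 0 | x≈0 | _ = inj₁ x≈0
... | 1 | x≈1 | _ = inj₂ x≈1
... | suc (suc _) | _ | ℕ.s≤s (ℕ.s≤s ())

square≈self[mod-2] : ∀ x → x * x ≈ x [mod 2 ]
square≈self[mod-2] x with parity x
... | inj₁ x≈0 = ≈-trans (*-cong x≈0 x≈0) (≈-sym x≈0)
... | inj₂ x≈1 = ≈-trans (*-cong x≈1 x≈1) (≈-sym x≈1)

x²-x≈0[mod-2] : ∀ x → x * x - x ≈ + 0 [mod 2 ]
x²-x≈0[mod-2] x = ≈⇒≈0 (square≈self[mod-2] x)

odd-factor[mod-2] : ∀ x y → x * y ≈ + 1 [mod 2 ] → x ≈ + 1 [mod 2 ]
odd-factor[mod-2] x y xy≈1 with parity x
... | inj₁ x≈0 = ⊥-elim (1≉0[mod-prime] prime[2] (≈-trans (≈-sym xy≈1) (*-congʳ y x≈0)))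
... | inj₂ x≈1 = x≈1

module _ (k : ℕ) {n : ℕ} {x y : ℤ} where

  private
    scaled-difference : ∣ + k * x - + k * y ∣ ≡ k ℕ.* ∣ x - y ∣
    scaled-difference = trans (cong ∣_∣ (identity (+ k) x y)) (ℤP.abs-* (+ k) (x - y))
      where identity : ∀ k x y → k * x - k * y ≡ k * (x - y)
            identity = solve-∀

  ≈-scale : x ≈ y [mod n ] → + k * x ≈ + k * y [mod k ℕ.* n ]
  ≈-scale (mod-intro n∣x-y) =
    mod-intro (subst (k ℕ.* n ∣_) (sym scaled-difference) (ℕD.*-monoʳ-∣ k n∣x-y))

  ≈-unscale : .{{_ : NonZero k}} → + k * x ≈ + k * y [mod k ℕ.* n ] → x ≈ y [mod n ]
  ≈-unscale (mod-intro kn∣kx-ky) =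
    mod-intro (ℕD.*-cancelˡ-∣ k (subst (k ℕ.* n ∣_) scaled-difference kn∣kx-ky))

odd-square≈1[mod-8] : ∀ x → x ≈ + 1 [mod 2 ] → x * x ≈ + 1 [mod 8 ]
odd-square≈1[mod-8] x x≈1 with ≈⇒multiple x≈1
... | t , refl = ≈0⇒≈ (begin
  (+ 1 + t * + 2) * (+ 1 + t * + 2) - + 1  ≡⟨ expand t ⟩
  + 4 * (t * t + t)                        ≈⟨ ≈-scale 4 t²+t≈0 ⟩
  + 4 * + 0                                ∎)
  where
    open ≈-Reasoning 8
    expand : ∀ t → (+ 1 + t * + 2) * (+ 1 + t * + 2) - + 1 ≡ + 4 * (t * t + t)
    expand = solve-∀
    doubling : ∀ t → t + t ≡ t * + 2
    doubling = solve-∀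
    t²+t≈0 : t * t + t ≈ + 0 [mod 2 ]
    t²+t≈0 = ≈-trans (+-congʳ t (square≈self[mod-2] t))
                     (≈-trans (≈-reflexive (doubling t)) (multiple≈0 t))

-- Prime divisors

coprime-∣⇒*∣ : ∀ {m n c} → Coprime m n → m ∣ c → n ∣ c → m ℕ.* n ∣ c
coprime-∣⇒*∣ {m} {n} coprime m∣c (ℕD.divides q refl) =
  ℕD.*-monoˡ-∣ n (coprime-divisor coprime (subst (m ∣_) (ℕP.*-comm q n) m∣c))

distinct-primes-∣⇒product∣ : ∀ {ps c} → Unique ps → All Prime ps → (∀ {p} → p ∈ ps → p ∣ c) →
  product ps ∣ c
distinct-primes-∣⇒product∣ {[]}     _            _                ps∣c = ℕD.1∣ _
distinct-primes-∣⇒product∣ {p ∷ ps} (p∉ps ∷ uniq) (prime-p ∷ primes) ps∣c =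
  coprime-∣⇒*∣ (coprime-prime prime-p p∤product) (ps∣c (here refl))
    (distinct-primes-∣⇒product∣ uniq primes (λ q∈ps → ps∣c (there q∈ps)))
  where
    p∤product : ¬ (p ∣ product ps)
    p∤product p∣product = All.lookup p∉ps (factorisationHasAllPrimeFactors prime-p p∣product primes) refl

∃prime-factor : ∀ {i} → i ≢ 0 → i ≢ 1 → ∃[ p ] Prime p × p ∣ i
∃prime-factor {i} i≢0 i≢1 with factorise i {{ℕ.≢-nonZero i≢0}}
... | record { factors = [] ; isFactorisation = i≡1 } = ⊥-elim (i≢1 i≡1)
... | record { factors = p ∷ ps ; isFactorisation = i≡p*ps ; factorsPrime = prime-p ∷ _ } =
  p , prime-p , subst (p ∣_) (sym i≡p*ps) (ℕD.m∣m*n (product ps))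

no-common-prime⇒coprime : ∀ {m n} → n ≢ 0 → (∀ {p} → Prime p → p ∣ m → p ∣ n → ⊥) →
  Coprime m n
no-common-prime⇒coprime {m} {n} n≢0 no-common {i} (i∣m , i∣n) with i ℕ.≟ 1
... | yes i≡1 = i≡1
... | no i≢1 with ∃prime-factor (λ { refl → n≢0 (ℕD.0∣⇒≡0 i∣n) }) i≢1
...   | p , prime-p , p∣i = ⊥-elim (no-common prime-p (ℕD.∣-trans p∣i i∣m) (ℕD.∣-trans p∣i i∣n))

prime∤common : ∀ {p m n} → Prime p → gcd m n ≡ 1 → p ∣ m → p ∣ n → ⊥
prime∤common prime-p gcd≡1 p∣m p∣n =
  ¬prime[1] (subst Prime (ℕD.∣1⇒≡1 (subst (_ ∣_) gcd≡1 (gcd-greatest p∣m p∣n))) prime-p)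

-- The Kronecker symbol and M

private
  ≡ᵇ-true⇒≡ : ∀ {m n} → (m ≡ᵇ n) ≡ true → m ≡ n
  ≡ᵇ-true⇒≡ {m} {n} m≡ᵇn = ℕP.≡ᵇ⇒≡ m n (subst T (sym m≡ᵇn) tt)

kronecker≢-1⇒residue : ∀ D {p} → Prime p → p ≢ 2 → kronecker D p ≢ -[1+ 0 ] →
  ∃[ x ] x * x ≈ D [mod p ]
kronecker≢-1⇒residue D {zero} prime-0 = ⊥-elim (¬prime[0] prime-0)
kronecker≢-1⇒residue D {p@(suc _)} _ p≢2 χ≢-1
  with p ≡ᵇ 2 in p≡ᵇ2 | D %ℕ p ≡ᵇ 0 in D%p≡ᵇ0
     | any (λ x → ((+ x) * (+ x) - D) %ℕ p ≡ᵇ 0) (upTo p) in found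
... | true  | _     | _     = ⊥-elim (p≢2 (≡ᵇ-true⇒≡ p≡ᵇ2))
... | false | true  | _     = + 0 , ≈-sym (%ℕ≡⇒≈ p (≡ᵇ-true⇒≡ D%p≡ᵇ0))
... | false | false | true  with satisfied (any⁻ _ (upTo p) (subst T (sym found) tt))
...   | x , x²-D%p≡ᵇ0 = + x , ≈0⇒≈ (%ℕ≡⇒≈ p (ℕP.≡ᵇ⇒≡ _ 0 x²-D%p≡ᵇ0))
kronecker≢-1⇒residue D {suc _} _ _ χ≢-1 | false | false | false = ⊥-elim (χ≢-1 refl)

kronecker≡-1⇒nonresidue : ∀ D {p} → Prime p → p ≢ 2 → kronecker D p ≡ -[1+ 0 ] →
  ∀ x → ¬ (x * x ≈ D [mod p ])
kronecker≡-1⇒nonresidue D {zero} prime-0 = ⊥-elim (¬prime[0] prime-0)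
kronecker≡-1⇒nonresidue D {p@(suc _)} _ p≢2 χ≡-1 x x²≈D
  with p ≡ᵇ 2 in p≡ᵇ2 | D %ℕ p ≡ᵇ 0 in D%p≡ᵇ0
     | any (λ x → ((+ x) * (+ x) - D) %ℕ p ≡ᵇ 0) (upTo p) in found
... | true  | _     | _     = p≢2 (≡ᵇ-true⇒≡ p≡ᵇ2)
kronecker≡-1⇒nonresidue D {suc _} _ _ () _ _ | false | true  | _
kronecker≡-1⇒nonresidue D {suc _} _ _ () _ _ | false | false | true
kronecker≡-1⇒nonresidue D {p@(suc _)} _ _ _ x x²≈D | false | false | false =
  subst T found (any⁺ _ (lose (∈-upTo⁺ (n%ℕd<d x p)) (ℕP.≡⇒≡ᵇ _ 0 r²-D%p≡0)))
  where
    r = x %ℕ p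
    r≈x : + r ≈ x [mod p ]
    r≈x = ≈-sym (≈-%ℕ x p)
    r²-D%p≡0 : ((+ r) * (+ r) - D) %ℕ p ≡ 0
    r²-D%p≡0 = ≈⇒%ℕ≡ p (≈⇒≈0 (≈-trans (*-cong r≈x r≈x) x²≈D)) (ℕ.>-nonZero⁻¹ p)

private
  %ℕ-from-≈ : ∀ {x r} m n .{{_ : NonZero m}} s k →
    x ≈ + r [mod m ℕ.* n ] → + r ≡ + s + k * + m → s ℕ.< m → x %ℕ m ≡ s
  %ℕ-from-≈ m n s k x≈r r≡s+km =
    ≈⇒%ℕ≡ m (≈-trans (≈-weaken m n x≈r) (≈-by-multiple k r≡s+km))

  ≢2+ : ∀ {r s} → r ≡ 0 ⊎ r ≡ 1 → r ≢ 2 ℕ.+ s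
  ≢2+ (inj₁ refl) ()
  ≢2+ (inj₂ refl) ()

residues-mod-8 : ∀ D → D %ℕ 4 ≡ 0 ⊎ D %ℕ 4 ≡ 1 →
    D %ℕ 2 ≡ 0 × D ≈ + 0 [mod 4 ]
  ⊎ D %ℕ 2 ≡ 1 × D %ℕ 8 ≡ 1
  ⊎ D %ℕ 2 ≡ 1 × D %ℕ 8 ≡ 5
residues-mod-8 D D%4≤1 with D %ℕ 8 in D%8 | ≈-%ℕ D 8 | n%ℕd<d D 8
... | 0 | D≈0 | _ = inj₁ (%ℕ-from-≈ 2 4 0 (+ 0) D≈0 refl ℕ.z<s , ≈-weaken 4 2 D≈0)
... | 1 | D≈1 | _ = inj₂ (inj₁ (%ℕ-from-≈ 2 4 1 (+ 0) D≈1 refl (ℕ.s<s ℕ.z<s) , refl))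
... | 2 | D≈2 | _ = ⊥-elim (≢2+ D%4≤1 (%ℕ-from-≈ 4 2 2 (+ 0) D≈2 refl (ℕ.s<s (ℕ.s<s ℕ.z<s))))
... | 3 | D≈3 | _ = ⊥-elim (≢2+ D%4≤1 (%ℕ-from-≈ 4 2 3 (+ 0) D≈3 refl (ℕ.s<s (ℕ.s<s (ℕ.s<s ℕ.z<s)))))
... | 4 | D≈4 | _ = inj₁ (%ℕ-from-≈ 2 4 0 (+ 2) D≈4 refl ℕ.z<s ,
                          ≈-trans (≈-weaken 4 2 D≈4) (≈-by-multiple (+ 1) refl))
... | 5 | D≈5 | _ = inj₂ (inj₂ (%ℕ-from-≈ 2 4 1 (+ 2) D≈5 refl (ℕ.s<s ℕ.z<s) , refl))
... | 6 | D≈6 | _ = ⊥-elim (≢2+ D%4≤1 (%ℕ-from-≈ 4 2 2 (+ 1) D≈6 refl (ℕ.s<s (ℕ.s<s ℕ.z<s))))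
... | 7 | D≈7 | _ = ⊥-elim (≢2+ D%4≤1 (%ℕ-from-≈ 4 2 3 (+ 1) D≈7 refl (ℕ.s<s (ℕ.s<s (ℕ.s<s ℕ.z<s)))))
... | suc (suc (suc (suc (suc (suc (suc (suc _))))))) | _
    | ℕ.s<s (ℕ.s<s (ℕ.s<s (ℕ.s<s (ℕ.s<s (ℕ.s<s (ℕ.s<s (ℕ.s<s ())))))))

kronecker-at-2 : ∀ D → D %ℕ 4 ≡ 0 ⊎ D %ℕ 4 ≡ 1 →
    D ≈ + 0 [mod 4 ] × kronecker D 2 ≡ + 0
  ⊎ D ≈ + 1 [mod 8 ] × kronecker D 2 ≡ + 1
  ⊎ D ≈ + 5 [mod 8 ] × kronecker D 2 ≡ -[1+ 0 ]
kronecker-at-2 D D%4≤1 with residues-mod-8 D D%4≤1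
... | inj₁ (D%2≡0 , D≈0) rewrite D%2≡0 = inj₁ (D≈0 , refl)
... | inj₂ (inj₁ (D%2≡1 , D%8≡1)) rewrite D%2≡1 | D%8≡1 = inj₂ (inj₁ (%ℕ≡⇒≈ 8 D%8≡1 , refl))
... | inj₂ (inj₂ (D%2≡1 , D%8≡5)) rewrite D%2≡1 | D%8≡5 = inj₂ (inj₂ (%ℕ≡⇒≈ 8 D%8≡5 , refl))

kronecker[D,2]≡-1⇒≈5[mod-8] : ∀ D → D %ℕ 4 ≡ 0 ⊎ D %ℕ 4 ≡ 1 → kronecker D 2 ≡ -[1+ 0 ] →
  D ≈ + 5 [mod 8 ]
kronecker[D,2]≡-1⇒≈5[mod-8] D D%4≤1 χ≡-1 =
  [ (λ (_ , χ≡0) → ⊥-elim (-1≢0 (trans (sym χ≡-1) χ≡0)))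
  , [ (λ (_ , χ≡1) → ⊥-elim (-1≢1 (trans (sym χ≡-1) χ≡1))) , proj₁ ]′
  ]′ (kronecker-at-2 D D%4≤1)
  where
    -1≢0 : -[1+ 0 ] ≢ + 0
    -1≢0 ()
    -1≢1 : -[1+ 0 ] ≢ + 1
    -1≢1 ()

kronecker[D,2]≢-1⇒≈0[mod-4]⊎≈1[mod-8] : ∀ D → D %ℕ 4 ≡ 0 ⊎ D %ℕ 4 ≡ 1 →
  kronecker D 2 ≢ -[1+ 0 ] →
  D ≈ + 0 [mod 4 ] ⊎ D ≈ + 1 [mod 8 ]
kronecker[D,2]≢-1⇒≈0[mod-4]⊎≈1[mod-8] D D%4≤1 χ≢-1 =
  [ (λ (D≈0 , _) → inj₁ D≈0)
  , [ (λ (D≈1 , _) → inj₂ D≈1) , (λ (_ , χ≡-1) → ⊥-elim (χ≢-1 χ≡-1)) ]′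
  ]′ (kronecker-at-2 D D%4≤1)

MPrime : ℤ → ℕ → ℕ → Set
MPrime D N p = Prime p × p ∣ N × kronecker D p ≢ -[1+ 0 ]

MPrime? : ∀ D N → Decidable (MPrime D N)
MPrime? D N p = prime? p ×-dec (p ∣? N) ×-dec ¬? (kronecker D p ℤ.≟ -[1+ 0 ])

MPrime⇒∣M : ∀ {D N p} → 1 ≤ N → MPrime D N p → p ∣ M D N
MPrime⇒∣M {D} {suc _} {p} _ MPrime-p@(_ , p∣N , _) =
  ∈⇒∣product (∈-filter⁺ (MPrime? D _) (∈-upTo⁺ (ℕ.s≤s (ℕD.∣⇒≤ p∣N))) MPrime-p)

MPrimes∣⇒M∣ : ∀ {D N c} → (∀ {p} → MPrime D N p → p ∣ c) → M D N ∣ c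
MPrimes∣⇒M∣ {D} {N} MPrimes∣c = distinct-primes-∣⇒product∣
  (Unique.filter⁺ (MPrime? D N) (Unique.upTo⁺ (suc N)))
  (All.tabulate (λ p∈ → proj₁ (proj₂ (∈-filter⁻ (MPrime? D N) {xs = upTo (suc N)} p∈))))
  (λ p∈ → MPrimes∣c (proj₂ (∈-filter⁻ (MPrime? D N) {xs = upTo (suc N)} p∈)))

-- Binary quadratic forms

eval : Form → ℤ → ℤ → ℤ
eval (form A B C) x y = A * x * x + B * x * y + C * y * y

eval-cong : ∀ {n A A' B B' C C' x x' y y'} →
  A ≈ A' [mod n ] → B ≈ B' [mod n ] → C ≈ C' [mod n ] → x ≈ x' [mod n ] → y ≈ y' [mod n ] →
  eval (form A B C) x y ≈ eval (form A' B' C') x' y' [mod n ]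
eval-cong A≈A' B≈B' C≈C' x≈x' y≈y' =
  +-cong (+-cong (*-cong (*-cong A≈A' x≈x') x≈x') (*-cong (*-cong B≈B' x≈x') y≈y'))
         (*-cong (*-cong C≈C' y≈y') y≈y')

eval-congʳ : ∀ {n} Q {x x' y y'} → x ≈ x' [mod n ] → y ≈ y' [mod n ] →
  eval Q x y ≈ eval Q x' y' [mod n ]
eval-congʳ (form A B C) = eval-cong (≈-refl {x = A}) (≈-refl {x = B}) (≈-refl {x = C})

A-act : ∀ Q γ → A (act Q γ) ≡ eval Q (a γ) (c γ)
A-act (form _ _ _) (mat _ _ _ _) = refl

content : Form → ℕ
content Q = gcd (gcd ∣ A Q ∣ ∣ B Q ∣) ∣ C Q ∣

infix 4 _∣ᶠ_
_∣ᶠ_ : ℕ → Form → Set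
n ∣ᶠ Q = A Q ≈ + 0 [mod n ] × B Q ≈ + 0 [mod n ] × C Q ≈ + 0 [mod n ]

∣content⇒∣ᶠ : ∀ {n} Q → n ∣ content Q → n ∣ᶠ Q
∣content⇒∣ᶠ {n} (form A B C) n∣content =
  ∣⇒≈0 (ℕD.∣-trans n∣gcd[A,B] (gcd[m,n]∣m ∣ A ∣ ∣ B ∣)) ,
  ∣⇒≈0 (ℕD.∣-trans n∣gcd[A,B] (gcd[m,n]∣n ∣ A ∣ ∣ B ∣)) ,
  ∣⇒≈0 (ℕD.∣-trans n∣content (gcd[m,n]∣n (gcd ∣ A ∣ ∣ B ∣) ∣ C ∣))
  where
    n∣gcd[A,B] : n ∣ gcd (∣ A ∣) (∣ B ∣)
    n∣gcd[A,B] = ℕD.∣-trans n∣content (gcd[m,n]∣m (gcd ∣ A ∣ ∣ B ∣) ∣ C ∣)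

∣ᶠ⇒∣content : ∀ {n} Q → n ∣ᶠ Q → n ∣ content Q
∣ᶠ⇒∣content (form A B C) (A≈0 , B≈0 , C≈0) =
  gcd-greatest (gcd-greatest (≈0⇒∣ A≈0) (≈0⇒∣ B≈0)) (≈0⇒∣ C≈0)

-- The right-hand sides are the coefficients of act (form 0 0 0) γ, which reduce to 0.
∣ᶠ-act : ∀ {n} Q γ → n ∣ᶠ Q → n ∣ᶠ act Q γ
∣ᶠ-act (form A B C) (mat a b c d) (A≈0 , B≈0 , C≈0) =
  +-cong (+-cong (A≈0 ⊛ a ⊛ a) (B≈0 ⊛ a ⊛ c)) (C≈0 ⊛ c ⊛ c) ,
  +-cong (+-cong (*-congˡ (+ 2) A≈0 ⊛ a ⊛ b) (B≈0 ⊛ (a * d + b * c))) (*-congˡ (+ 2) C≈0 ⊛ c ⊛ d) ,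
  +-cong (+-cong (A≈0 ⊛ b ⊛ b) (B≈0 ⊛ b ⊛ d)) (C≈0 ⊛ d ⊛ d)
  where
    infixl 7 _⊛_
    _⊛_ : ∀ {x y n} → x ≈ y [mod n ] → ∀ z → x * z ≈ y * z [mod n ]
    h ⊛ z = *-congʳ z h

act-invSL2 : ∀ Q γ → InSL2 γ → act (act Q γ) (invSL2 γ) ≡ Q
act-invSL2 (form A B C) (mat a b c d) det≡1 =
  form-cong (unscale (A-identity A B C a b c d)) (unscale (B-identity A B C a b c d))
            (unscale (C-identity A B C a b c d))
  where
    form-cong : ∀ {A A' B B' C C'} → A ≡ A' → B ≡ B' → C ≡ C' → form A B C ≡ form A' B' C'
    form-cong refl refl refl = refl
    unscale : ∀ {X Y} → X ≡ (a * d - b * c) * (a * d - b * c) * Y → X ≡ Y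
    unscale {Y = Y} X≡det²Y = trans X≡det²Y (trans (cong (λ t → t * t * Y) det≡1) (ℤP.*-identityˡ Y))
    A-identity : ∀ A B C a b c d →
      let A' = A * a * a + B * a * c + C * c * c
          B' = + 2 * A * a * b + B * (a * d + b * c) + + 2 * C * c * d
          C' = A * b * b + B * b * d + C * d * d
      in A' * d * d + B' * d * - c + C' * - c * - c ≡ (a * d - b * c) * (a * d - b * c) * A
    A-identity = solve-∀
    B-identity : ∀ A B C a b c d →
      let A' = A * a * a + B * a * c + C * c * c
          B' = + 2 * A * a * b + B * (a * d + b * c) + + 2 * C * c * d
          C' = A * b * b + B * b * d + C * d * d
      in + 2 * A' * d * - b + B' * (d * a + - b * - c) + + 2 * C' * - c * a
           ≡ (a * d - b * c) * (a * d - b * c) * B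
    B-identity = solve-∀
    C-identity : ∀ A B C a b c d →
      let A' = A * a * a + B * a * c + C * c * c
          B' = + 2 * A * a * b + B * (a * d + b * c) + + 2 * C * c * d
          C' = A * b * b + B * b * d + C * d * d
      in A' * - b * - b + B' * - b * a + C' * a * a ≡ (a * d - b * c) * (a * d - b * c) * C
    C-identity = solve-∀

content-act : ∀ Q γ → InSL2 γ → content (act Q γ) ≡ content Q
content-act Q γ det≡1 = ℕD.∣-antisym
  (∣ᶠ⇒∣content Q (subst (content (act Q γ) ∣ᶠ_) (act-invSL2 Q γ det≡1)
    (∣ᶠ-act (act Q γ) (invSL2 γ) (∣content⇒∣ᶠ (act Q γ) ℕD.∣-refl))))
  (∣ᶠ⇒∣content (act Q γ) (∣ᶠ-act Q γ (∣content⇒∣ᶠ Q ℕD.∣-refl)))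

disc-act : ∀ Q γ → InSL2 γ → disc (act Q γ) ≡ disc Q
disc-act (form A B C) (mat a b c d) det≡1 = trans (identity A B C a b c d) (scale-by-det²)
  where
    identity : ∀ A B C a b c d →
      let A' = A * a * a + B * a * c + C * c * c
          B' = + 2 * A * a * b + B * (a * d + b * c) + + 2 * C * c * d
          C' = A * b * b + B * b * d + C * d * d
      in B' * B' - + 4 * A' * C' ≡ (a * d - b * c) * (a * d - b * c) * (B * B - + 4 * A * C)
    identity = solve-∀
    scale-by-det² : (a * d - b * c) * (a * d - b * c) * (B * B - + 4 * A * C) ≡ B * B - + 4 * A * C
    scale-by-det² = trans (cong (λ t → t * t * (B * B - + 4 * A * C)) det≡1) (ℤP.*-identityˡ _)

four-A-eval : ∀ Q x y →
  + 4 * A Q * eval Q x y ≡ (+ 2 * A Q * x + B Q * y) * (+ 2 * A Q * x + B Q * y) - disc Q * (y * y)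
four-A-eval (form A B C) x y = identity A B C x y
  where
    identity : ∀ A B C x y → + 4 * A * (A * x * x + B * x * y + C * y * y)
      ≡ (+ 2 * A * x + B * y) * (+ 2 * A * x + B * y) - (B * B - + 4 * A * C) * (y * y)
    identity = solve-∀

*-positive : ∀ {i j} → + 0 ℤ.< i → + 0 ℤ.< j → + 0 ℤ.< i * j
*-positive {i} {j} 0<i 0<j =
  subst (ℤ._< i * j) (ℤP.*-zeroʳ i) (ℤP.*-monoˡ-<-pos i {{ℤ.positive 0<i}} 0<j)

0<square : ∀ {x} → x ≢ + 0 → + 0 ℤ.< x * x
0<square {+ zero}   x≢0 = ⊥-elim (x≢0 refl)
0<square {+ suc _}  _   = ℤ.+<+ ℕ.z<s
0<square { -[1+ _ ]} _  = ℤ.+<+ ℕ.z<s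

0≤square : ∀ x → + 0 ℤ.≤ x * x
0≤square x with x ℤ.≟ + 0
... | yes refl = ℤ.+≤+ ℕ.z≤n
... | no x≢0   = ℤP.<⇒≤ (0<square x≢0)

eval-positive : ∀ Q {x y} → disc Q ℤ.< + 0 → + 0 ℤ.< A Q → ¬ (x ≡ + 0 × y ≡ + 0) →
  + 0 ℤ.< eval Q x y
eval-positive Q@(form A B C) {x} {y} D<0 0<A x,y≢0 with y ℤ.≟ + 0
... | yes refl =
  subst (+ 0 ℤ.<_) (sym (on-axis A B C x)) (*-positive 0<A (0<square (λ x≡0 → x,y≢0 (x≡0 , refl))))
  where
    on-axis : ∀ A B C x → A * x * x + B * x * + 0 + C * + 0 * + 0 ≡ A * (x * x)
    on-axis = solve-∀
... | no y≢0 = ℤP.*-cancelˡ-<-nonNeg (+ 4 * A) {{ℤ.nonNegative (ℤP.<⇒≤ 0<4A)}} (begin-strict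
  + 4 * A * + 0                   ≡⟨ ℤP.*-zeroʳ (+ 4 * A) ⟩
  + 0                             <⟨ ℤP.+-mono-≤-< (0≤square s) (*-positive -D>0 (0<square y≢0)) ⟩
  s * s + - disc Q * (y * y)      ≡⟨ cong (_+_ (s * s)) (ℤP.neg-distribˡ-* (disc Q) (y * y)) ⟨
  s * s - disc Q * (y * y)        ≡⟨ four-A-eval Q x y ⟨
  + 4 * A * eval Q x y            ∎)
  where
    open ℤP.≤-Reasoning
    s = + 2 * A * x + B * y
    0<4A : + 0 ℤ.< + 4 * A
    0<4A = *-positive {+ 4} (ℤ.+<+ ℕ.z<s) 0<A
    -D>0 : + 0 ℤ.< - disc Q
    -D>0 = ℤP.neg-mono-< D<0

eval≈on-axis : ∀ {n} Q x {y} → y ≈ + 0 [mod n ] → eval Q x y ≈ A Q * x * x [mod n ]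
eval≈on-axis (form A B C) x y≈0 =
  ≈-trans (eval-congʳ (form A B C) (≈-refl {x = x}) y≈0) (≈-reflexive (identity A B C x))
  where
    identity : ∀ A B C x → A * x * x + B * x * + 0 + C * + 0 * + 0 ≡ A * x * x
    identity = solve-∀

module _ {p : ℕ} (prime-p : Prime p) (Q : Form) {x y : ℤ}
         (A≉0 : ¬ (A Q ≈ + 0 [mod p ])) (x,y≉0 : ¬ (x ≈ + 0 [mod p ] × y ≈ + 0 [mod p ])) where

  eval≉0-on-axis : y ≈ + 0 [mod p ] → ¬ (eval Q x y ≈ + 0 [mod p ])
  eval≉0-on-axis y≈0 Qxy≈0 =
    [ (λ Ax≈0 → [ A≉0 , x≉0 ]′ (≈0-product[mod-prime] prime-p (A Q) x Ax≈0)) , x≉0 ]′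
      (≈0-product[mod-prime] prime-p (A Q * x) x Ax²≈0)
    where
      x≉0 : ¬ (x ≈ + 0 [mod p ])
      x≉0 x≈0 = x,y≉0 (x≈0 , y≈0)
      Ax²≈0 : A Q * x * x ≈ + 0 [mod p ]
      Ax²≈0 = ≈-trans (≈-sym (eval≈on-axis Q x y≈0)) Qxy≈0

  -- Q(x, y) ≡ 0 forces s² ≡ D y² for s = 2Ax + By; dividing by y makes D a square.
  eval≉0-nonresidue : p ≢ 2 → (∀ z → ¬ (z * z ≈ disc Q [mod p ])) → ¬ (eval Q x y ≈ + 0 [mod p ])
  eval≉0-nonresidue p≢2 nonresidue Qxy≈0 with ≈0-or-invertible[mod-prime] prime-p y
  ... | inj₁ y≈0 = eval≉0-on-axis y≈0 Qxy≈0
  ... | inj₂ (u , uy≈1) = nonresidue (s * u) (begin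
    (s * u) * (s * u)               ≡⟨ regroup s u ⟩
    (s * s) * (u * u)               ≈⟨ *-congʳ (u * u) s²≈Dy² ⟩
    disc Q * (y * y) * (u * u)      ≡⟨ regroup′ (disc Q) y u ⟩
    disc Q * ((u * y) * (u * y))    ≈⟨ *-congˡ (disc Q) (*-cong uy≈1 uy≈1) ⟩
    disc Q * (+ 1 * + 1)            ≡⟨ ℤP.*-identityʳ (disc Q) ⟩
    disc Q                          ∎)
    where
      open ≈-Reasoning p
      s = + 2 * A Q * x + B Q * y
      4AQ≈0 : + 4 * A Q * eval Q x y ≈ + 0 [mod p ]
      4AQ≈0 = ≈-trans (*-congˡ (+ 4 * A Q) Qxy≈0) (≈-reflexive (ℤP.*-zeroʳ (+ 4 * A Q)))
      s²≈Dy² : s * s ≈ disc Q * (y * y) [mod p ]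
      s²≈Dy² = ≈0⇒≈ (≈-trans (≈-reflexive (sym (four-A-eval Q x y))) 4AQ≈0)
      regroup : ∀ s u → (s * u) * (s * u) ≡ (s * s) * (u * u)
      regroup = solve-∀
      regroup′ : ∀ D y u → D * (y * y) * (u * u) ≡ D * ((u * y) * (u * y))
      regroup′ = solve-∀

odd-coefficients : ∀ Q → disc Q ≈ + 5 [mod 8 ] →
  A Q ≈ + 1 [mod 2 ] × B Q ≈ + 1 [mod 2 ] × C Q ≈ + 1 [mod 2 ]
odd-coefficients (form A B C) D≈5 = A≈1 , B≈1 , C≈1
  where
    D≈1 : B * B - + 4 * A * C ≈ + 1 [mod 2 ]
    D≈1 = ≈-trans (≈-weaken 2 4 D≈5) (≈-by-multiple (+ 2) refl)
    B≈1 : B ≈ + 1 [mod 2 ]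
    B≈1 = begin
      B                                        ≈⟨ square≈self[mod-2] B ⟨
      B * B                                    ≡⟨ identity A B C ⟩
      (B * B - + 4 * A * C) + (+ 2 * A * C) * + 2 ≈⟨ +-cong D≈1 (multiple≈0 (+ 2 * A * C)) ⟩
      + 1 + + 0                                ∎
      where
        open ≈-Reasoning 2
        identity : ∀ A B C → B * B ≡ (B * B - + 4 * A * C) + (+ 2 * A * C) * + 2
        identity = solve-∀
    AC≈1 : A * C ≈ + 1 [mod 2 ]
    AC≈1 = ≈-trans (≈-unscale 4 (begin
      + 4 * (A * C)                  ≡⟨ identity A B C ⟩
      B * B - (B * B - + 4 * A * C)  ≈⟨ -‿cong (odd-square≈1[mod-8] B B≈1) D≈5 ⟩
      + 1 - + 5                      ≡⟨⟩
      + 4 * -[1+ 0 ]                 ∎)) (≈-by-multiple -[1+ 0 ] refl)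
      where
        open ≈-Reasoning 8
        identity : ∀ A B C → + 4 * (A * C) ≡ B * B - (B * B - + 4 * A * C)
        identity = solve-∀
    A≈1 : A ≈ + 1 [mod 2 ]
    A≈1 = odd-factor[mod-2] A C AC≈1
    C≈1 : C ≈ + 1 [mod 2 ]
    C≈1 = odd-factor[mod-2] C A (≈-trans (≈-reflexive (ℤP.*-comm C A)) AC≈1)

eval≈x²+xy+y²[mod-2] : ∀ Q {x x' y y'} → disc Q ≈ + 5 [mod 8 ] →
  x ≈ x' [mod 2 ] → y ≈ y' [mod 2 ] →
  eval Q x y ≈ eval (form (+ 1) (+ 1) (+ 1)) x' y' [mod 2 ]
eval≈x²+xy+y²[mod-2] Q@(form A B C) D≈5 x≈x' y≈y' =
  let A≈1 , B≈1 , C≈1 = odd-coefficients Q D≈5 in eval-cong A≈1 B≈1 C≈1 x≈x' y≈y'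

eval≈1[mod-2] : ∀ Q {x y} → disc Q ≈ + 5 [mod 8 ] → ¬ (x ≈ + 0 [mod 2 ] × y ≈ + 0 [mod 2 ]) →
  eval Q x y ≈ + 1 [mod 2 ]
eval≈1[mod-2] Q {x} {y} D≈5 x,y≉0 with parity x | parity y
... | inj₁ x≈0 | inj₁ y≈0 = ⊥-elim (x,y≉0 (x≈0 , y≈0))
... | inj₁ x≈0 | inj₂ y≈1 = eval≈x²+xy+y²[mod-2] Q D≈5 x≈0 y≈1
... | inj₂ x≈1 | inj₁ y≈0 = eval≈x²+xy+y²[mod-2] Q D≈5 x≈1 y≈0
... | inj₂ x≈1 | inj₂ y≈1 =
  ≈-trans (eval≈x²+xy+y²[mod-2] Q D≈5 x≈1 y≈1) (≈-by-multiple (+ 1) refl)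

-- Principal forms

principalForm : ℤ → ℤ → ℤ → Form
principalForm e k m = form (+ 1) (+ 2 * m + e) (m * m + m * e - k)

disc-principalForm : ∀ e k m → disc (principalForm e k m) ≡ e * e + k * + 4
disc-principalForm e k m = identity e k m
  where
    identity : ∀ e k m →
      (+ 2 * m + e) * (+ 2 * m + e) - + 4 * + 1 * (m * m + m * e - k) ≡ e * e + k * + 4
    identity = solve-∀

-- m is chosen so that 2x + (2m + e)y ≡ zy, whence 4Q(x, y) ≡ (z² - D)y² ≡ 0.
principalForm-root[mod-odd-prime] : ∀ {p} → Prime p → p ≢ 2 → ∀ {e k x y z} →
  z * z ≈ e * e + k * + 4 [mod p ] → ¬ (y ≈ + 0 [mod p ]) →
  ∃[ m ] eval (principalForm e k m) x y ≈ + 0 [mod p ]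
principalForm-root[mod-odd-prime] {p} prime-p p≢2 {e} {k} {x} {y} {z} z²≈D y≉0
  with ≈0-or-invertible[mod-prime] prime-p y | ∃half[mod-odd-prime] prime-p p≢2
... | inj₁ y≈0        | _        = ⊥-elim (y≉0 y≈0)
... | inj₂ (u , uy≈1) | h , h2≈1 = m , ≈0-cancelˡ[mod-prime] prime-p 4≉0 4Q≈0
  where
    D = e * e + k * + 4
    t = z * y - + 2 * x - e * y
    m = h * u * t
    disc≡D = disc-principalForm e k m
    s = + 2 * + 1 * x + (+ 2 * m + e) * y
    s≈zy : s ≈ z * y [mod p ]
    s≈zy = begin
      s                                         ≡⟨ expand x y e h u t ⟩
      + 2 * x + e * y + (h * + 2) * (u * y) * t ≈⟨ +-congˡ (+ 2 * x + e * y) (*-congʳ t h·2·u·y≈1) ⟩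
      + 2 * x + e * y + + 1 * + 1 * t           ≡⟨ collapse x y e z ⟩
      z * y                                     ∎
      where
        open ≈-Reasoning p
        h·2·u·y≈1 : (h * + 2) * (u * y) ≈ + 1 * + 1 [mod p ]
        h·2·u·y≈1 = *-cong h2≈1 uy≈1
        expand : ∀ x y e h u t →
          + 2 * + 1 * x + (+ 2 * (h * u * t) + e) * y ≡ + 2 * x + e * y + (h * + 2) * (u * y) * t
        expand = solve-∀
        collapse : ∀ x y e z → + 2 * x + e * y + + 1 * + 1 * (z * y - + 2 * x - e * y) ≡ z * y
        collapse = solve-∀
    4Q≈0 : + 4 * + 1 * eval (principalForm e k m) x y ≈ + 0 [mod p ]
    4Q≈0 = begin
      + 4 * + 1 * eval (principalForm e k m) x y   ≡⟨ four-A-eval (principalForm e k m) x y ⟩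
      s * s - disc (principalForm e k m) * (y * y) ≡⟨ cong (λ δ → s * s - δ * (y * y)) disc≡D ⟩
      s * s - D * (y * y)                          ≈⟨ -‿cong (*-cong s≈zy s≈zy) (≈-refl {x = D * (y * y)}) ⟩
      (z * y) * (z * y) - D * (y * y)              ≡⟨ factor z y D ⟩
      (z * z - D) * (y * y)                        ≈⟨ *-congʳ (y * y) (≈⇒≈0 z²≈D) ⟩
      + 0 * (y * y)                                ∎
      where
        open ≈-Reasoning p
        factor : ∀ z y D → (z * y) * (z * y) - D * (y * y) ≡ (z * z - D) * (y * y)
        factor = solve-∀
    4≉0 : ¬ (+ 4 * + 1 ≈ + 0 [mod p ])
    4≉0 4≈0 = [ 2≉0 , 2≉0 ]′ (≈0-product[mod-prime] prime-p (+ 2) (+ 2) 4≈0)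
      where 2≉0 = 2≉0[mod-odd-prime] prime-p p≢2

principalForm-root[mod-2] : ∀ {e k x y} → e ≡ + 0 ⊎ e ≡ + 1 →
  e + k * + 4 ≈ + 0 [mod 4 ] ⊎ e + k * + 4 ≈ + 1 [mod 8 ] → y ≈ + 1 [mod 2 ] →
  ∃[ m ] eval (principalForm e k m) x y ≈ + 0 [mod 2 ]
principalForm-root[mod-2] {k = k} {x} {y} (inj₁ refl) _ y≈1 = m , (begin
  eval Q x y                                ≈⟨ eval-congʳ Q (≈-refl {x = x}) y≈1 ⟩
  eval Q x (+ 1)                            ≡⟨ identity x k ⟩
  (x * x - x) + (m * m - m) + (m * x) * + 2 ≈⟨ +-cong (+-cong (x²-x≈0 x) (x²-x≈0 m)) (multiple≈0 (m * x)) ⟩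
  + 0                                       ∎)
  where
    open ≈-Reasoning 2
    x²-x≈0 = x²-x≈0[mod-2]
    m = k - x
    Q = principalForm (+ 0) k m
    identity : ∀ x k → let m = k - x in
      + 1 * x * x + (+ 2 * m + + 0) * x * + 1 + (m * m + m * + 0 - k) * + 1 * + 1
        ≡ (x * x - x) + (m * m - m) + (m * x) * + 2
    identity = solve-∀
principalForm-root[mod-2] {k = k} {x} {y} (inj₂ refl) D≈0∨1 y≈1 = + 0 , (begin
  eval Q x y                ≈⟨ eval-congʳ Q (≈-refl {x = x}) y≈1 ⟩
  eval Q x (+ 1)            ≡⟨ identity x k ⟩
  (x * x - x) + x * + 2 - k ≈⟨ -‿cong (+-cong (x²-x≈0[mod-2] x) (multiple≈0 x)) k≈0 ⟩
  + 0                       ∎)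
  where
    open ≈-Reasoning 2
    Q = principalForm (+ 1) k (+ 0)
    identity : ∀ x k → + 1 * x * x + (+ 2 * + 0 + + 1) * x * + 1 + (+ 0 * + 0 + + 0 * + 1 - k) * + 1 * + 1
                       ≡ (x * x - x) + x * + 2 - k
    identity = solve-∀
    D≈1[mod-4] : + 1 + k * + 4 ≈ + 1 [mod 4 ]
    D≈1[mod-4] = ≈-by-multiple k refl
    4k≡D-1 : ∀ k → + 4 * k ≡ + 1 + k * + 4 - + 1
    4k≡D-1 = solve-∀
    k≈0 : k ≈ + 0 [mod 2 ]
    k≈0 = [ (λ D≈0 → ⊥-elim (≉-by-computation tt (≈-trans (≈-sym D≈1[mod-4]) D≈0)))
          , (λ D≈1 → ≈-unscale 4 (≈-trans (≈-reflexive (4k≡D-1 k)) (≈⇒≈0 D≈1))) ]′ D≈0∨1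

0∨1⇒square≡self : ∀ {e} → e ≡ + 0 ⊎ e ≡ + 1 → e * e ≡ e
0∨1⇒square≡self (inj₁ refl) = refl
0∨1⇒square≡self (inj₂ refl) = refl

principalForm∈Q : ∀ {D N e k} m → e ≡ + 0 ⊎ e ≡ + 1 → D ≡ e + k * + 4 →
  InQ D N (principalForm e k m)
principalForm∈Q {N = N} {e} {k} m e≡0∨1 D≡e+4k =
  trans (cong (λ g → gcd g ∣ C₀ ∣) (gcd-zeroˡ ∣ B₀ ∣)) (gcd-zeroˡ ∣ C₀ ∣) ,
  trans (disc-principalForm e k m) (trans (cong (_+ k * + 4) (0∨1⇒square≡self e≡0∨1)) (sym D≡e+4k)) ,
  ℤ.+<+ ℕ.z<s ,
  gcd-zeroˡ N
  where
    B₀ = + 2 * m + e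
    C₀ = m * m + m * e - k

-- Transforms preserving 𝒬(D, N)

unimodular⇒column≢0 : ∀ γ → InSL2 γ → ¬ (a γ ≡ + 0 × c γ ≡ + 0)
unimodular⇒column≢0 (mat a b c d) det≡1 (a≡0 , c≡0) =
  unimodular⇒column≉0[mod-prime] prime[2] {b = b} {d = d} det≡1 (≈-reflexive a≡0 , ≈-reflexive c≡0)

act-∈Q : ∀ {D N} Q γ → D ℤ.< + 0 → InSL2 γ → InQ D N Q → gcd ∣ eval Q (a γ) (c γ) ∣ N ≡ 1 →
  InQ D N (act Q γ)
act-∈Q {N = N} Q γ D<0 det≡1 (content≡1 , disc≡D , 0<A , _) eval-coprime =
  trans (content-act Q γ det≡1) content≡1 ,
  trans (disc-act Q γ det≡1) disc≡D ,
  subst (+ 0 ℤ.<_) (sym (A-act Q γ)) (eval-positive Q disc<0 0<A (unimodular⇒column≢0 γ det≡1)) ,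
  subst (λ t → gcd ∣ t ∣ N ≡ 1) (sym (A-act Q γ)) eval-coprime
  where
    disc<0 : disc Q ℤ.< + 0
    disc<0 = subst (ℤ._< + 0) (sym disc≡D) D<0

Γ₀[M]⇒eval-coprime : ∀ {D N} Q γ → 1 ≤ N → IsImagQuadOrderDisc D → InΓ0 (M D N) γ → InQ D N Q →
  gcd ∣ eval Q (a γ) (c γ) ∣ N ≡ 1
Γ₀[M]⇒eval-coprime {D} {N} Q (mat a b c d) 1≤N (_ , D%4≤1) (det≡1 , c≡0[M])
                   (_ , disc≡D , _ , gcd[A,N]≡1) =
  coprime⇒gcd≡1 (no-common-prime⇒coprime (ℕ.≢-nonZero⁻¹ N {{ℕ.>-nonZero 1≤N}}) λ {p} prime-p p∣Q p∣N →
    eval≉0 prime-p p∣N (kronecker D p ℤ.≟ -[1+ 0 ]) (p ℕ.≟ 2) (∣⇒≈0 p∣Q))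
  where
    M∣c : M D N ∣ ∣ c ∣
    M∣c = ≈0⇒∣ {x = c} (mod-intro c≡0[M])
    A≉0 : ∀ {p} → Prime p → p ∣ N → ¬ (A Q ≈ + 0 [mod p ])
    A≉0 prime-p p∣N A≈0 = prime∤common prime-p gcd[A,N]≡1 (≈0⇒∣ A≈0) p∣N
    column≉0 : ∀ {p} → Prime p → ¬ (a ≈ + 0 [mod p ] × c ≈ + 0 [mod p ])
    column≉0 prime-p = unimodular⇒column≉0[mod-prime] prime-p {b = b} {d = d} det≡1
    eval≉0 : ∀ {p} → Prime p → p ∣ N → Dec (kronecker D p ≡ -[1+ 0 ]) → Dec (p ≡ 2) →
      ¬ (eval Q a c ≈ + 0 [mod p ])
    eval≉0 prime-p p∣N (no χ≢-1) _ =
      eval≉0-on-axis prime-p Q (A≉0 prime-p p∣N) (column≉0 prime-p)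
        (∣⇒≈0 (ℕD.∣-trans (MPrime⇒∣M 1≤N (prime-p , p∣N , χ≢-1)) M∣c))
    eval≉0 {p} prime-p p∣N (yes χ≡-1) (no p≢2) =
      eval≉0-nonresidue prime-p Q (A≉0 prime-p p∣N) (column≉0 prime-p) p≢2
        (subst (λ D → ∀ z → ¬ (z * z ≈ D [mod p ])) (sym disc≡D) (kronecker≡-1⇒nonresidue D prime-p p≢2 χ≡-1))
    eval≉0 prime-p p∣N (yes χ≡-1) (yes refl) Q≈0 = 1≉0[mod-prime] prime[2] (≈-trans (≈-sym Q≈1) Q≈0)
      where
        D≈5 : disc Q ≈ + 5 [mod 8 ]
        D≈5 = subst (_≈ + 5 [mod 8 ]) (sym disc≡D) (kronecker[D,2]≡-1⇒≈5[mod-8] D D%4≤1 χ≡-1)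
        Q≈1 : eval Q a c ≈ + 1 [mod 2 ]
        Q≈1 = eval≈1[mod-2] Q D≈5 (column≉0 prime-p)

Γ₀[M]⇒act-∈Q : ∀ {D N} γ → 1 ≤ N → IsImagQuadOrderDisc D → InΓ0 (M D N) γ →
  ∀ Q → InQ D N Q → InQ D N (act Q γ)
Γ₀[M]⇒act-∈Q γ 1≤N D-disc γ∈Γ₀ Q Q∈𝒬 =
  act-∈Q Q γ (proj₁ D-disc) (proj₁ γ∈Γ₀) Q∈𝒬
    (Γ₀[M]⇒eval-coprime Q γ 1≤N D-disc γ∈Γ₀ Q∈𝒬)

act-∈Q⇒Γ₀[M] : ∀ {D N} γ → 1 ≤ N → IsImagQuadOrderDisc D → InSL2 γ →
  (∀ Q → InQ D N Q → InQ D N (act Q γ)) → InΓ0 (M D N) γ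
act-∈Q⇒Γ₀[M] {D} {N} γ@(mat a b c d) 1≤N (_ , D%4≤1) det≡1 preserves-𝒬 =
  det≡1 , mod-elim (∣⇒≈0 {x = c} (MPrimes∣⇒M∣ λ {p} MPrime-p →
    decidable-stable (p ∣? ∣ c ∣) (¬¬p∣c MPrime-p)))
  where
    e = + (D %ℕ 4)
    k = D /ℕ 4
    e≡0∨1 : e ≡ + 0 ⊎ e ≡ + 1
    e≡0∨1 = Sum.map (cong (λ r → + r)) (cong (λ r → + r)) D%4≤1
    D≡e+4k : D ≡ e + k * + 4
    D≡e+4k = a≡a%ℕn+[a/ℕn]*n D 4
    D≡e²+4k : D ≡ e * e + k * + 4
    D≡e²+4k = trans D≡e+4k (cong (λ t → t + k * + 4) (sym (0∨1⇒square≡self e≡0∨1)))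
    root : ∀ {p} → Prime p → kronecker D p ≢ -[1+ 0 ] → ¬ (c ≈ + 0 [mod p ]) → Dec (p ≡ 2) →
      ∃[ m ] eval (principalForm e k m) a c ≈ + 0 [mod p ]
    root prime-p χ≢-1 c≉0 (no p≢2) =
      let z , z²≈D = kronecker≢-1⇒residue D prime-p p≢2 χ≢-1 in
      principalForm-root[mod-odd-prime] prime-p p≢2 {x = a} {z = z}
        (≈-trans z²≈D (≈-reflexive D≡e²+4k)) c≉0
    root prime-p χ≢-1 c≉0 (yes refl) =
      principalForm-root[mod-2] {x = a} e≡0∨1
        (subst (λ D → D ≈ + 0 [mod 4 ] ⊎ D ≈ + 1 [mod 8 ]) D≡e+4k
          (kronecker[D,2]≢-1⇒≈0[mod-4]⊎≈1[mod-8] D D%4≤1 χ≢-1))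
        ([ (λ c≈0 → ⊥-elim (c≉0 c≈0)) , (λ c≈1 → c≈1) ]′ (parity c))
    ¬¬p∣c : ∀ {p} → MPrime D N p → ¬ ¬ (p ∣ ∣ c ∣)
    ¬¬p∣c {p} (prime-p , p∣N , χ≢-1) p∤c =
      let m , Q[a,c]≈0 = root prime-p χ≢-1 (λ c≈0 → p∤c (≈0⇒∣ c≈0)) (p ℕ.≟ 2)
          Q = principalForm e k m
          _ , _ , _ , gcd[Q[a,c],N]≡1 = preserves-𝒬 Q (principalForm∈Q {N = N} m e≡0∨1 D≡e+4k)
      in prime∤common prime-p (subst (λ t → gcd ∣ t ∣ N ≡ 1) (A-act Q γ) gcd[Q[a,c],N]≡1)
           (≈0⇒∣ Q[a,c]≈0) p∣N

proposition6p3 : (N : ℕ) → 1 ≤ N → (D : ℤ) → IsImagQuadOrderDisc D →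
    (Γ : Mat → Set) → IsSubgroupSL2 Γ → (∀ γ → InΓ1 N γ → Γ γ) →
    ActsOnQ D N Γ ⇔ (∀ γ → Γ γ → InΓ0 (M D N) γ)
proposition6p3 N 1≤N D D-disc Γ Γ-subgroup _ = mk⇔
  (λ acts γ γ∈Γ → act-∈Q⇒Γ₀[M] γ 1≤N D-disc (⊆SL2 γ γ∈Γ) (acts γ γ∈Γ))
  (λ Γ⊆Γ₀ γ γ∈Γ → Γ₀[M]⇒act-∈Q γ 1≤N D-disc (Γ⊆Γ₀ γ γ∈Γ))
  where open IsSubgroupSL2 Γ-subgroup using (⊆SL2)
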